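{- Let $m$ and $M$ be two positive integers. Then $\mathsf{D}(\llbracket -m,M \rrbracket ) \geq m+M -\rho (m,M)$.
   Context: A finite sequence of integers $S=s_1\cdots s_n$ is an unordered finite multiset of integers; $n=|S|$ is its length. $S$ is a zero-sum sequence if $\sum_{i=1}^n s_i=0$, and a minimal zero-sum sequence if moreover $\sum_{i\in I}s_i\neq 0$ for every non-empty proper subset $I\subsetneq\{1,\dots,n\}$. For integers $a\le b$, $\llbracket a,b\rrbracket$ denotes the set of integers $i$ with $a\le i\le b$. For positive integers $m,M$, $\mathsf{D}(\llbracket -m,M\rrbracket)$ is the maximal length of a minimal zero-sum sequence all of whose elements lie in $\llbracket -m,M\rrbracket$. Define $$\rho(m,M)=\min\{t\in\mathbb{Z}_{\ge 0} : \text{there is } t'\in\mathbb{Z}_{\ge0},\ 0\le t'\le t,\ \gcd(M-t',\,m-(t-t'))=1\}.$$ -}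

module Defs where

open import Data.Nat as ℕ using (ℕ; zero; suc)
open import Data.Integer as ℤ using (ℤ; +_; -_)
open import Data.Integer.GCD using (gcd)
open import Data.Fin using (Fin)
open import Data.Fin.Subset using (Subset; Nonempty; ⊤; inside; outside)
open import Data.Vec using (Vec; []; _∷_)
open import Data.Vec.Relation.Unary.All using (All)
open import Data.Product using (_×_; Σ; ∃; ∃-syntax)
open import Relation.Binary.PropositionalEquality using (_≡_; _≢_)
open import Relation.Nullary using (¬_)

subSum : ∀ {n} → Vec ℤ n → Subset n → ℤ
subSum [] [] = + 0
subSum (x ∷ xs) (inside ∷ I) = x ℤ.+ subSum xs I
subSum (x ∷ xs) (outside ∷ I) = subSum xs I

IsZeroSum : ∀ {n} → Vec ℤ n → Set
IsZeroSum s = subSum s ⊤ ≡ + 0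

IsMinimalZeroSum : ∀ {n} → Vec ℤ n → Set
IsMinimalZeroSum {n} s =
  (1 ℕ.≤ n) × IsZeroSum s ×
  (∀ (I : Subset n) → Nonempty I → I ≢ ⊤ → subSum s I ≢ + 0)

InInterval : ℤ → ℤ → ℤ → Set
InInterval a b x = (a ℤ.≤ x) × (x ℤ.≤ b)

OverInterval : ∀ {n} → ℕ → ℕ → Vec ℤ n → Set
OverInterval m M s = All (InInterval (- (+ m)) (+ M)) s

-- "D(⟦-m,M⟧) ≥ k": there is a minimal zero-sum sequence over ⟦-m,M⟧ of length ≥ k
-- (D is the maximum of such lengths, so this is exactly D ≥ k)
D≥ : ℕ → ℕ → ℤ → Set
D≥ m M k = ∃[ n ] Σ (Vec ℤ n) (λ s → OverInterval m M s × IsMinimalZeroSum s × (k ℤ.≤ + n))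

RhoAdmissible : ℕ → ℕ → ℕ → Set
RhoAdmissible m M t =
  ∃[ t' ] (t' ℕ.≤ t) × (gcd (+ M ℤ.- + t') (+ m ℤ.- (+ t ℤ.- + t')) ≡ + 1)

IsRho : ℕ → ℕ → ℕ → Set
IsRho m M r = RhoAdmissible m M r × (∀ t → t ℕ.< r → ¬ RhoAdmissible m M t)

{-# OPTIONS --safe #-}
-- For coprime a, b ≥ 1 the sequence aᵇ (−b)ᵃ of length a + b is a minimal
-- zero-sum sequence: a subsequence with i copies of a and j copies of −b sums
-- to zero iff i a = j b, so b ∣ i, forcing (i , j) = (0 , 0) or (b , a).
-- An admissible t for ρ(m,M) with witness t' yields such a pair a = M − t',
-- b = m − (t − t') with a + b = m + M − t. Since gcd(M,1) = gcd(1,m) = 1,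
-- both t = m − 1 and t = M − 1 are admissible, so ρ < min(m, M) and a, b > 0.
module Submission where

open import Defs
open import Data.Nat using (ℕ; _≤_)
open import Data.Integer using (+_; _-_; _+_)

open import Data.Nat as ℕ using (zero; suc; _<_; NonZero; >-nonZero; >-nonZero⁻¹)
import Data.Nat.Properties as ℕ
open import Data.Nat.Coprimality as Coprimality
  using (Coprime; coprime⇒gcd≡1; gcd≡1⇒coprime; coprime-divisor; 1-coprimeTo)
open import Data.Nat.Divisibility using (_∣_; divides; ∣⇒≤)
open import Data.Integer as ℤ using (ℤ; 0ℤ; -_; _*_)
import Data.Integer.Properties as ℤ
open import Data.Integer.GCD using (gcd)
open import Data.Integer.Tactic.RingSolver using (solve-∀)
open import Data.Fin.Subset using (Subset; Nonempty; ⊥; ⊤; inside; outside; ∣_∣; _∈_)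
open import Data.Fin.Subset.Properties using (∉⊥; ∣⊤∣≡n; ∣p∣≤n; ∣p∣≡n⇒p≡⊤)
open import Data.Vec using (Vec; []; _∷_; _++_; replicate; splitAt)
open import Data.Vec.Relation.Unary.All using (All; []; _∷_)
open import Data.Vec.Relation.Unary.All.Properties using (++⁺)
open import Data.Product using (_×_; _,_; ∃₂; proj₁; proj₂; uncurry)
open import Data.Sum using (_⊎_; inj₁; inj₂)
open import Relation.Binary.PropositionalEquality
open ≡-Reasoning

++-replicate : ∀ m n {A : Set} (x : A) → replicate m x ++ replicate n x ≡ replicate (m ℕ.+ n) x
++-replicate zero    n x = refl
++-replicate (suc m) n x = cong (x ∷_) (++-replicate m n x)

All-replicate : ∀ n {A : Set} {P : A → Set} {x : A} → P x → All P (replicate n x)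
All-replicate zero    px = []
All-replicate (suc n) px = px ∷ All-replicate n px

∣p∣≡0⇒p≡⊥ : ∀ {n} (p : Subset n) → ∣ p ∣ ≡ 0 → p ≡ ⊥
∣p∣≡0⇒p≡⊥ []            _     = refl
∣p∣≡0⇒p≡⊥ (inside  ∷ p) ()
∣p∣≡0⇒p≡⊥ (outside ∷ p) ∣p∣≡0 = cong (outside ∷_) (∣p∣≡0⇒p≡⊥ p ∣p∣≡0)

subSum-++ : ∀ {m n} (xs : Vec ℤ m) (ys : Vec ℤ n) (I : Subset m) (J : Subset n) →
  subSum (xs ++ ys) (I ++ J) ≡ subSum xs I + subSum ys J
subSum-++ []       ys []            J = sym (ℤ.+-identityˡ _)
subSum-++ (x ∷ xs) ys (inside  ∷ I) J =
  trans (cong (λ s → x + s) (subSum-++ xs ys I J)) (sym (ℤ.+-assoc x _ _))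
subSum-++ (x ∷ xs) ys (outside ∷ I) J = subSum-++ xs ys I J

subSum-replicate : ∀ {n} (x : ℤ) (I : Subset n) → subSum (replicate n x) I ≡ + ∣ I ∣ * x
subSum-replicate x []            = refl
subSum-replicate x (inside  ∷ I) =
  trans (cong (λ s → x + s) (subSum-replicate x I)) (sym (ℤ.suc-* (+ ∣ I ∣) x))
subSum-replicate x (outside ∷ I) = subSum-replicate x I

coprime-balance : ∀ {a b i j} .{{_ : NonZero b}} → Coprime a b → i ≤ b →
  i ℕ.* a ≡ j ℕ.* b → (i ≡ 0 × j ≡ 0) ⊎ (i ≡ b × j ≡ a)
coprime-balance {a} {b} {zero}  {j} _   _   ia≡jb = inj₁ (refl , ℕ.m*n≡0⇒m≡0 j b (sym ia≡jb))
coprime-balance {a} {b} {suc i} {j} cop i≤b ia≡jb = inj₂ (i≡b , j≡a)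
  where
  b∣i : b ∣ suc i
  b∣i = coprime-divisor (Coprimality.sym cop) (divides j (trans (ℕ.*-comm a (suc i)) ia≡jb))
  i≡b : suc i ≡ b
  i≡b = ℕ.≤-antisym i≤b (∣⇒≤ b∣i)
  j≡a : j ≡ a
  j≡a = ℕ.*-cancelʳ-≡ j a b (begin
    j ℕ.* b     ≡⟨ sym ia≡jb ⟩
    suc i ℕ.* a ≡⟨ cong (ℕ._* a) i≡b ⟩
    b ℕ.* a     ≡⟨ ℕ.*-comm b a ⟩
    a ℕ.* b     ∎)

i*a+j*-b≡0⇒i*a≡j*b : ∀ {i a j b} → + i * + a + + j * - + b ≡ 0ℤ → i ℕ.* a ≡ j ℕ.* b
i*a+j*-b≡0⇒i*a≡j*b {i} {a} {j} {b} eq = ℤ.+-injective (begin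
  + (i ℕ.* a) ≡⟨ ℤ.pos-* i a ⟩
  + i * + a   ≡⟨ ℤ.i-j≡0⇒i≡j _ _ (trans (cong (λ s → + i * + a + s) (ℤ.neg-distribʳ-* (+ j) (+ b))) eq) ⟩
  + j * + b   ≡⟨ sym (ℤ.pos-* j b) ⟩
  + (j ℕ.* b) ∎)

balanced : (a b : ℕ) → Vec ℤ (b ℕ.+ a)
balanced a b = replicate b (+ a) ++ replicate a (- + b)

balanced-subSum : ∀ a b (I : Subset b) (J : Subset a) →
  subSum (balanced a b) (I ++ J) ≡ + ∣ I ∣ * + a + + ∣ J ∣ * - + b
balanced-subSum a b I J = trans (subSum-++ (replicate b (+ a)) (replicate a (- + b)) I J)
  (cong₂ _+_ (subSum-replicate (+ a) I) (subSum-replicate (- + b) J))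

balanced-isZeroSum : ∀ a b → IsZeroSum (balanced a b)
balanced-isZeroSum a b = begin
  subSum (balanced a b) ⊤              ≡⟨ cong (subSum (balanced a b)) (sym (++-replicate b a inside)) ⟩
  subSum (balanced a b) (⊤ {b} ++ ⊤)   ≡⟨ balanced-subSum a b ⊤ ⊤ ⟩
  + ∣ ⊤ {b} ∣ * + a + + ∣ ⊤ {a} ∣ * - + b
    ≡⟨ cong₂ (λ i j → + i * + a + + j * - + b) (∣⊤∣≡n b) (∣⊤∣≡n a) ⟩
  + b * + a + + a * - + b              ≡⟨ cancel (+ b) (+ a) ⟩
  0ℤ                                   ∎
  where
  cancel : ∀ x y → x * y + y * - x ≡ 0ℤ
  cancel = solve-∀

balanced-zeroSubSum : ∀ a b .{{_ : NonZero b}} → Coprime a b → (K : Subset (b ℕ.+ a)) →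
  subSum (balanced a b) K ≡ 0ℤ → K ≡ ⊥ ⊎ K ≡ ⊤
balanced-zeroSubSum a b cop K sum≡0 with splitAt b K
... | I , J , refl
  with coprime-balance cop (∣p∣≤n I)
         (i*a+j*-b≡0⇒i*a≡j*b {∣ I ∣} {a} {∣ J ∣} {b} (trans (sym (balanced-subSum a b I J)) sum≡0))
... | inj₁ (∣I∣≡0 , ∣J∣≡0) = inj₁ (begin
  I ++ J     ≡⟨ cong₂ _++_ (∣p∣≡0⇒p≡⊥ I ∣I∣≡0) (∣p∣≡0⇒p≡⊥ J ∣J∣≡0) ⟩
  ⊥ {b} ++ ⊥ ≡⟨ ++-replicate b a outside ⟩
  ⊥          ∎)
... | inj₂ (∣I∣≡b , ∣J∣≡a) = inj₂ (begin
  I ++ J     ≡⟨ cong₂ _++_ (∣p∣≡n⇒p≡⊤ {p = I} ∣I∣≡b) (∣p∣≡n⇒p≡⊤ {p = J} ∣J∣≡a) ⟩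
  ⊤ {b} ++ ⊤ ≡⟨ ++-replicate b a inside ⟩
  ⊤          ∎)

balanced-isMinimalZeroSum : ∀ a b .{{_ : NonZero b}} → Coprime a b → IsMinimalZeroSum (balanced a b)
balanced-isMinimalZeroSum a b cop =
  ℕ.≤-trans (>-nonZero⁻¹ b) (ℕ.m≤m+n b a) , balanced-isZeroSum a b , proper-nonzero
  where
  proper-nonzero : ∀ K → Nonempty K → K ≢ ⊤ → subSum (balanced a b) K ≢ 0ℤ
  proper-nonzero K (x , x∈K) K≢⊤ sum≡0 with balanced-zeroSubSum a b cop K sum≡0
  ... | inj₁ K≡⊥ = ∉⊥ (subst (x ∈_) K≡⊥ x∈K)
  ... | inj₂ K≡⊤ = K≢⊤ K≡⊤

balanced-overInterval : ∀ {m M a b} → a ≤ M → b ≤ m → OverInterval m M (balanced a b)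
balanced-overInterval {a = a} {b} a≤M b≤m =
  ++⁺ (All-replicate b (ℤ.neg-≤-pos , ℤ.+≤+ a≤M))
      (All-replicate a (ℤ.neg-mono-≤ (ℤ.+≤+ b≤m) , ℤ.neg-≤-pos))

D≥-coprime : ∀ {m M a b} .{{_ : NonZero b}} → Coprime a b → a ≤ M → b ≤ m → D≥ m M (+ (b ℕ.+ a))
D≥-coprime {a = a} {b} cop a≤M b≤m =
  b ℕ.+ a , balanced a b , balanced-overInterval a≤M b≤m , balanced-isMinimalZeroSum a b cop , ℤ.≤-refl

+m-+n≡+[m∸n] : ∀ {m n} → n ≤ m → + m - + n ≡ + (m ℕ.∸ n)
+m-+n≡+[m∸n] {m} {n} n≤m = trans (ℤ.m-n≡m⊖n m n) (ℤ.⊖-≥ n≤m)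

admissiblePair-∸ : ∀ {m M t t'} → t' ≤ t → t' ≤ M → t ℕ.∸ t' ≤ m →
  (+ M - + t' ≡ + (M ℕ.∸ t')) × (+ m - (+ t - + t') ≡ + (m ℕ.∸ (t ℕ.∸ t')))
admissiblePair-∸ {m} t'≤t t'≤M t-t'≤m = +m-+n≡+[m∸n] t'≤M ,
  trans (cong (λ z → + m - z) (+m-+n≡+[m∸n] t'≤t)) (+m-+n≡+[m∸n] t-t'≤m)

coprime⇒rhoAdmissible : ∀ {m M t t'} → t' ≤ t → t' ≤ M → t ℕ.∸ t' ≤ m →
  Coprime (M ℕ.∸ t') (m ℕ.∸ (t ℕ.∸ t')) → RhoAdmissible m M t
coprime⇒rhoAdmissible t'≤t t'≤M t-t'≤m cop =
  _ , t'≤t , trans (uncurry (cong₂ gcd) (admissiblePair-∸ t'≤t t'≤M t-t'≤m)) (cong +_ (coprime⇒gcd≡1 cop))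

rhoAdmissible-pred-m : ∀ m M → RhoAdmissible (suc m) M m
rhoAdmissible-pred-m m M = coprime⇒rhoAdmissible ℕ.z≤n ℕ.z≤n (ℕ.n≤1+n m)
  (subst (Coprime M) (sym (ℕ.m+n∸n≡m 1 m)) (Coprimality.sym (1-coprimeTo M)))

rhoAdmissible-pred-M : ∀ m M → RhoAdmissible m (suc M) M
rhoAdmissible-pred-M m M = coprime⇒rhoAdmissible ℕ.≤-refl (ℕ.n≤1+n M)
  (subst (_≤ m) (sym (ℕ.n∸n≡0 M)) ℕ.z≤n)
  (subst₂ Coprime (sym (ℕ.m+n∸n≡m 1 M)) (cong (m ℕ.∸_) (sym (ℕ.n∸n≡0 M))) (1-coprimeTo m))

rho<min : ∀ {m M r} → 1 ≤ m → 1 ≤ M → IsRho m M r → r < m × r < M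
rho<min {suc m} {suc M} (ℕ.s≤s ℕ.z≤n) (ℕ.s≤s ℕ.z≤n) (_ , least) =
  ℕ.s≤s (ℕ.≮⇒≥ (λ m<r → least m m<r (rhoAdmissible-pred-m m (suc M)))) ,
  ℕ.s≤s (ℕ.≮⇒≥ (λ M<r → least M M<r (rhoAdmissible-pred-M (suc m) M)))

rhoAdmissible⇒coprimeSplit : ∀ {m M t} → t < m → t < M → RhoAdmissible m M t →
  ∃₂ λ a b → Coprime a b × 1 ≤ b × a ≤ M × b ≤ m × (+ m + + M) - + t ≡ + (b ℕ.+ a)
rhoAdmissible⇒coprimeSplit {m} {M} {t} t<m t<M (t' , t'≤t , gcd≡1) =
  a , b , cop , ℕ.m<n⇒0<n∸m t-t'<m , ℕ.m∸n≤m M t' , ℕ.m∸n≤m m (t ℕ.∸ t') , length≡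
  where
  a = M ℕ.∸ t'
  b = m ℕ.∸ (t ℕ.∸ t')
  t-t'<m : t ℕ.∸ t' < m
  t-t'<m = ℕ.≤-<-trans (ℕ.m∸n≤m t t') t<m
  +a+b : (+ M - + t' ≡ + a) × (+ m - (+ t - + t') ≡ + b)
  +a+b = admissiblePair-∸ t'≤t (ℕ.<⇒≤ (ℕ.≤-<-trans t'≤t t<M)) (ℕ.<⇒≤ t-t'<m)
  cop : Coprime a b
  cop = gcd≡1⇒coprime (ℤ.+-injective (trans (sym (uncurry (cong₂ gcd) +a+b)) gcd≡1))
  regroup : ∀ x y z w → (x + y) - z ≡ (x - (z - w)) + (y - w)
  regroup = solve-∀
  length≡ : (+ m + + M) - + t ≡ + (b ℕ.+ a)
  length≡ = begin
    (+ m + + M) - + t                   ≡⟨ regroup (+ m) (+ M) (+ t) (+ t') ⟩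
    (+ m - (+ t - + t')) + (+ M - + t') ≡⟨ cong₂ _+_ (proj₂ +a+b) (proj₁ +a+b) ⟩
    + b + + a                           ≡⟨ sym (ℤ.pos-+ b a) ⟩
    + (b ℕ.+ a)                         ∎

lemma1p4 : (m M : ℕ) → 1 ≤ m → 1 ≤ M → (r : ℕ) → IsRho m M r →
    D≥ m M ((+ m + + M) - + r)
lemma1p4 m M 1≤m 1≤M r ρ@(admissible , _)
  with rho<min 1≤m 1≤M ρ
... | r<m , r<M
  with rhoAdmissible⇒coprimeSplit r<m r<M admissible
... | a , b , cop , 1≤b , a≤M , b≤m , length≡ =
  subst (D≥ m M) (sym length≡) (D≥-coprime {{>-nonZero 1≤b}} cop a≤M b≤m)
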